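{- Let $q$ be a power of an odd prime, let $\lambda\in\mathbb{F}_q$ be a non-square, and let $f\in\mathbb{F}_q[X]$ be a polynomial of degree one with non-zero constant term. Then every directed path of Type 1 in $\mathcal{G}(\lambda,f)$ contains at most $\lfloor \frac{3}{4}q+\frac{17}{4}\rfloor$ vertices.
   Context: For a polynomial $f\in\mathbb{F}_q[X]$ and a non-square $\lambda\in\mathbb{F}_q$, $\mathcal{G}(\lambda,f)$ is the directed graph with vertex set $\mathbb{F}_q$ and an edge from $x$ to $y$ iff $(y^2-f(x))(\lambda y^2-f(x))=0$ (loops allowed). Paths have distinct vertices. Weights: an edge $(x,y)$ has weight $0$ if $y^2=f(x)$ and weight $1$ otherwise (so the edge into vertex $0$ has weight $0$). A trail is a directed path all of whose edges have the same weight; its length is its number of edges. A directed path is of Type $n$ if it contains a trail of length $n$ but no trail of length greater than $n$. -}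

module Defs where

open import Level using (0ℓ)
open import Data.Nat as ℕ using (ℕ; suc; _∸_)
open import Data.Fin using (Fin)
open import Data.Product using (Σ; ∃; _×_)
open import Data.Sum using (_⊎_)
open import Data.List using (List; length; _++_)
open import Data.List.Relation.Unary.Unique.Propositional using (Unique)
open import Data.List.Relation.Unary.Linked using (Linked)
open import Function.Bundles using (_↔_)
open import Relation.Binary.PropositionalEquality using (_≡_; _≢_)
open import Relation.Nullary using (¬_)
open import Algebra.Structures using (IsCommutativeRing)

record FiniteField (q : ℕ) : Set₁ where
  infixl 6 _+_ _-_
  infixl 7 _*_
  field
    Carrier : Set
    _+_ _*_ : Carrier → Carrier → Carrier
    -_ : Carrier → Carrier
    0# 1# : Carrier
    isCommutativeRing : IsCommutativeRing _≡_ _+_ _*_ -_ 0# 1#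
    0≢1 : 0# ≢ 1#
    inverse : ∀ x → x ≢ 0# → Σ Carrier (λ y → x * y ≡ 1#)
    enumeration : Carrier ↔ Fin q

  _-_ : Carrier → Carrier → Carrier
  x - y = x + (- y)

  IsSquare : Carrier → Set
  IsSquare a = Σ Carrier (λ y → y * y ≡ a)

module GraphDefs {q : ℕ} (F : FiniteField q) where
  open FiniteField F

  module _ (λ' : Carrier) (f : Carrier → Carrier) where

    Edge : Carrier → Carrier → Set
    Edge x y = (y * y - f x) * (λ' * (y * y) - f x) ≡ 0#

    Edge₀ : Carrier → Carrier → Set
    Edge₀ x y = Edge x y × (y * y ≡ f x)

    Edge₁ : Carrier → Carrier → Set
    Edge₁ x y = Edge x y × ¬ (y * y ≡ f x)

    IsPath : List Carrier → Set
    IsPath vs = Unique vs × Linked Edge vs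

    IsTrail : List Carrier → Set
    IsTrail vs = IsPath vs × (Linked Edge₀ vs ⊎ Linked Edge₁ vs)

    edgeCount : List Carrier → ℕ
    edgeCount vs = length vs ∸ 1

    ContainsTrail : List Carrier → ℕ → Set
    ContainsTrail P n =
      ∃ λ xs → ∃ λ ts → ∃ λ zs →
        P ≡ xs ++ ts ++ zs × IsTrail ts × edgeCount ts ≡ n

    IsOfType : List Carrier → ℕ → Set
    IsOfType P n = ContainsTrail P n × (∀ m → n ℕ.< m → ¬ ContainsTrail P m)

linPoly : {q : ℕ} (F : FiniteField q) → FiniteField.Carrier F → FiniteField.Carrier F →
          FiniteField.Carrier F → FiniteField.Carrier F
linPoly F a b x = FiniteField._+_ F (FiniteField._*_ F a x) b

module Submission where

-- In a path of Type 1 the weights of consecutive edges alternate.  Let v be an interior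
-- vertex with predecessor u and successor w.  If u → v has weight 0 then v² = f(u) and
-- f(v) = λw² is a non-square; if it has weight 1 then λv² = f(u) and f(v) = w² is a
-- square.  As f is injective and the u are distinct, the squares v² are distinct within
-- each class, so there are at most N + S interior vertices, where N (resp. S) counts the
-- pairs {±x} on which f takes some non-square (resp. square) value.  Now N + S is
-- (q + 1)/2 plus the number of "mixed" pairs, and if v lies in a mixed pair with f(v) a
-- non-square, then t = f(−v) is a square while 2b − t = f(v) is not.  Hence
-- N + S ≤ q + 1 − R, where R counts the t with t and 2b − t both squares.  Parametrising
-- the conic w² + z² = 2b by the lines through one of its points gives q ≤ 4R + 2, so
-- 4·|P| ≤ 4(N + S + 2) ≤ 3q + 14.

open import Level using (0ℓ)
open import Defs
open import Algebra.Bundles using (CommutativeRing)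
open import Algebra.Structures using (IsCommutativeRing)
open import Algebra.Solver.Ring.AlmostCommutativeRing using (fromCommutativeRing; _-Raw-AlmostCommutative⟶_)
open import Data.Bool using (if_then_else_)
open import Data.Empty using (⊥-elim)
open import Data.Fin as Fin using (Fin)
import Data.Fin.Properties as Fin
open import Data.Integer as ℤ using (ℤ; -[1+_]; _⊖_; _◃_)
import Data.Integer.Properties as ℤ
open import Data.List using (List; []; _∷_; _++_; length; map; filter; tabulate)
import Data.List.Properties as List
open import Data.List.Membership.Propositional using (_∈_)
open import Data.List.Membership.Propositional.Properties
  using (∈-∃++; ∈-++⁻; ∈-++⁺ˡ; ∈-++⁺ʳ; ∈-map⁺; ∈-map⁻; ∈-filter⁺; ∈-filter⁻; ∈-tabulate⁺; ∈-length)
open import Data.List.Relation.Unary.All as All using (All; []; _∷_)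
open import Data.List.Relation.Unary.All.Properties using (all-filter)
open import Data.List.Relation.Unary.AllPairs as AllPairs using ([]; _∷_)
open import Data.List.Relation.Unary.Any as Any using (here; there)
open import Data.List.Relation.Unary.Linked using ([]; [-]; _∷_)
open import Data.List.Relation.Unary.Unique.Propositional using (Unique)
import Data.List.Relation.Unary.Unique.Propositional.Properties as Unique
open import Data.Maybe using (Maybe; just; nothing)
open import Data.Nat as ℕ using (ℕ; zero; suc; _∸_; _≤_; _<_; z≤n; s≤s)
import Data.Nat.Properties as ℕ
open import Algebra.Properties.CommutativeSemigroup ℕ.+-commutativeSemigroup using (interchange)
open import Data.Nat.Divisibility using (_∣_; divides)
open import Data.Nat.ListAction using (sum)
open import Data.Product using (Σ; _×_; _,_; proj₁; proj₂)
open import Data.Sign as Sign using (Sign)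
open import Data.Sum using (_⊎_; inj₁; inj₂)
open import Data.Sum.Properties using (inj₁-injective; inj₂-injective)
open import Function.Bundles using (_↔_; Inverse)
open import Relation.Binary.Definitions using (DecidableEquality)
open import Relation.Binary.PropositionalEquality hiding ([_])
open import Relation.Nullary using (¬_; Dec; yes; no; does)
open import Relation.Nullary.Decidable using (_×-dec_; _⊎-dec_; ¬?)
open import Relation.Unary using (Pred; Decidable; _⊆_; _∩_; _∪_; Satisfiable)
open import Relation.Unary.Properties using (_∩?_; _∪?_; ∁?)

-- The ring solver normalises coefficients by computation, so they must come from a ring
-- whose equality computes; ℤ embeds into every commutative ring.
module IntegerCoefficientSolver
  {A : Set} {add mul : A → A → A} {neg : A → A} {0r 1r : A}
  (isCommutativeRing : IsCommutativeRing _≡_ add mul neg 0r 1r) where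

  private
    R : CommutativeRing 0ℓ 0ℓ
    R = record { isCommutativeRing = isCommutativeRing }

    open CommutativeRing R using (_+_; _*_; -_; 0#; 1#; ring; semiring; +-assoc; +-comm; +-identityˡ; +-identityʳ; -‿inverseʳ)
    open import Algebra.Properties.Ring ring using (-‿distribˡ-*; -‿distribʳ-*; -‿involutive; -0#≈0#; -‿+-comm)
    open import Algebra.Properties.Semiring.Mult.TCOptimised semiring using (1+×; ×-homo-+; ×1-homo-*) renaming (_×_ to _·_)
    open ≡-Reasoning

    ν : ℕ → A
    ν n = n · 1#

    ⟦_⟧ : ℤ → A
    ⟦ ℤ.+ n ⟧ = ν n
    ⟦ -[1+ n ] ⟧ = - ν (suc n)

    ⟦⊖⟧ : ∀ m n → ⟦ m ⊖ n ⟧ ≡ ν m + - ν n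
    ⟦⊖⟧ zero zero = sym (trans (cong (0# +_) -0#≈0#) (+-identityʳ 0#))
    ⟦⊖⟧ zero (suc n) = sym (+-identityˡ _)
    ⟦⊖⟧ (suc m) zero = sym (trans (cong (ν (suc m) +_) -0#≈0#) (+-identityʳ _))
    ⟦⊖⟧ (suc m) (suc n) = begin
      ⟦ suc m ⊖ suc n ⟧                 ≡⟨ cong ⟦_⟧ (ℤ.[1+m]⊖[1+n]≡m⊖n m n) ⟩
      ⟦ m ⊖ n ⟧                         ≡⟨ ⟦⊖⟧ m n ⟩
      ν m + - ν n                       ≡⟨ cancel ⟨
      (1# + ν m) + - (1# + ν n)         ≡⟨ cong₂ (λ x y → x + - y) (1+× m 1#) (1+× n 1#) ⟨
      ν (suc m) + - ν (suc n)           ∎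
      where
      cancel : (1# + ν m) + - (1# + ν n) ≡ ν m + - ν n
      cancel = begin
        (1# + ν m) + - (1# + ν n)       ≡⟨ cong ((1# + ν m) +_) (-‿+-comm 1# (ν n)) ⟨
        (1# + ν m) + (- 1# + - ν n)     ≡⟨ cong (_+ (- 1# + - ν n)) (+-comm 1# (ν m)) ⟩
        (ν m + 1#) + (- 1# + - ν n)     ≡⟨ +-assoc (ν m) 1# _ ⟩
        ν m + (1# + (- 1# + - ν n))     ≡⟨ cong (ν m +_) (+-assoc 1# (- 1#) _) ⟨
        ν m + ((1# + - 1#) + - ν n)     ≡⟨ cong (λ x → ν m + (x + - ν n)) (-‿inverseʳ 1#) ⟩
        ν m + (0# + - ν n)              ≡⟨ cong (ν m +_) (+-identityˡ _) ⟩
        ν m + - ν n                     ∎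

    +-homo : ∀ i j → ⟦ i ℤ.+ j ⟧ ≡ ⟦ i ⟧ + ⟦ j ⟧
    +-homo (ℤ.+ m) (ℤ.+ n) = ×-homo-+ 1# m n
    +-homo (ℤ.+ m) -[1+ n ] = ⟦⊖⟧ m (suc n)
    +-homo -[1+ m ] (ℤ.+ n) = trans (⟦⊖⟧ n (suc m)) (+-comm _ _)
    +-homo -[1+ m ] -[1+ n ] = begin
      - ν (suc (suc (m ℕ.+ n)))         ≡⟨ cong (λ k → - ν (suc k)) (ℕ.+-suc m n) ⟨
      - ν (suc m ℕ.+ suc n)             ≡⟨ cong -_ (×-homo-+ 1# (suc m) (suc n)) ⟩
      - (ν (suc m) + ν (suc n))         ≡⟨ -‿+-comm _ _ ⟨
      - ν (suc m) + - ν (suc n)         ∎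

    signed : Sign → A → A
    signed Sign.+ x = x
    signed Sign.- x = - x

    ⟦◃⟧ : ∀ s n → ⟦ s ◃ n ⟧ ≡ signed s (ν n)
    ⟦◃⟧ Sign.+ zero = refl
    ⟦◃⟧ Sign.+ (suc n) = refl
    ⟦◃⟧ Sign.- zero = sym -0#≈0#
    ⟦◃⟧ Sign.- (suc n) = refl

    ⟦⟧-signAbs : ∀ i → ⟦ i ⟧ ≡ signed (ℤ.sign i) (ν ℤ.∣ i ∣)
    ⟦⟧-signAbs (ℤ.+ zero) = refl
    ⟦⟧-signAbs (ℤ.+ suc n) = refl
    ⟦⟧-signAbs -[1+ n ] = refl

    signed-* : ∀ s t x y → signed (s Sign.* t) (x * y) ≡ signed s x * signed t y
    signed-* Sign.+ Sign.+ x y = refl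
    signed-* Sign.+ Sign.- x y = -‿distribʳ-* x y
    signed-* Sign.- Sign.+ x y = -‿distribˡ-* x y
    signed-* Sign.- Sign.- x y = begin
      x * y                             ≡⟨ -‿involutive (x * y) ⟨
      - - (x * y)                       ≡⟨ cong -_ (-‿distribʳ-* x y) ⟩
      - (x * - y)                       ≡⟨ -‿distribˡ-* x (- y) ⟩
      - x * - y                         ∎

    *-homo : ∀ i j → ⟦ i ℤ.* j ⟧ ≡ ⟦ i ⟧ * ⟦ j ⟧
    *-homo i j = begin
      ⟦ (sᵢ Sign.* sⱼ) ◃ (nᵢ ℕ.* nⱼ) ⟧               ≡⟨ ⟦◃⟧ (sᵢ Sign.* sⱼ) (nᵢ ℕ.* nⱼ) ⟩
      signed (sᵢ Sign.* sⱼ) (ν (nᵢ ℕ.* nⱼ))         ≡⟨ cong (signed (sᵢ Sign.* sⱼ)) (×1-homo-* nᵢ nⱼ) ⟩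
      signed (sᵢ Sign.* sⱼ) (ν nᵢ * ν nⱼ)           ≡⟨ signed-* sᵢ sⱼ (ν nᵢ) (ν nⱼ) ⟩
      signed sᵢ (ν nᵢ) * signed sⱼ (ν nⱼ)           ≡⟨ cong₂ _*_ (⟦⟧-signAbs i) (⟦⟧-signAbs j) ⟨
      ⟦ i ⟧ * ⟦ j ⟧                                 ∎
      where
      sᵢ sⱼ : Sign
      nᵢ nⱼ : ℕ
      sᵢ = ℤ.sign i
      sⱼ = ℤ.sign j
      nᵢ = ℤ.∣ i ∣
      nⱼ = ℤ.∣ j ∣

    -‿homo : ∀ i → ⟦ ℤ.- i ⟧ ≡ - ⟦ i ⟧
    -‿homo (ℤ.+ zero) = sym -0#≈0#
    -‿homo (ℤ.+ suc n) = refl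
    -‿homo -[1+ n ] = sym (-‿involutive _)

    embedding : ℤ.+-*-rawRing -Raw-AlmostCommutative⟶ fromCommutativeRing R
    embedding = record
      { ⟦_⟧ = ⟦_⟧ ; +-homo = +-homo ; *-homo = *-homo ; -‿homo = -‿homo ; 0-homo = refl ; 1-homo = refl }

    equal? : ∀ i j → Maybe (⟦ i ⟧ ≡ ⟦ j ⟧)
    equal? i j with i ℤ.≟ j
    ... | yes i≡j = just (cong ⟦_⟧ i≡j)
    ... | no _ = nothing

  open import Algebra.Solver.Ring ℤ.+-*-rawRing (fromCommutativeRing R) embedding equal? public

module _ {A : Set} where

  length-≤-of-⊆ : {xs ys : List A} → Unique ys → (∀ {y} → y ∈ ys → y ∈ xs) → length ys ≤ length xs
  length-≤-of-⊆ [] _ = z≤n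
  length-≤-of-⊆ {xs} {y ∷ ys} (y∉ys ∷ ys-unique) ys⊆xs with ∈-∃++ (ys⊆xs (here refl))
  ... | us , vs , refl = begin
    suc (length ys)                    ≤⟨ s≤s (length-≤-of-⊆ ys-unique ys⊆us++vs) ⟩
    suc (length (us ++ vs))            ≡⟨ cong suc (List.length-++ us) ⟩
    suc (length us ℕ.+ length vs)      ≡⟨ ℕ.+-suc (length us) (length vs) ⟨
    length us ℕ.+ length (y ∷ vs)      ≡⟨ List.length-++ us ⟨
    length (us ++ y ∷ vs)              ∎
    where
    open ℕ.≤-Reasoning
    ys⊆us++vs : ∀ {z} → z ∈ ys → z ∈ us ++ vs
    ys⊆us++vs {z} z∈ys with ∈-++⁻ us (ys⊆xs (there z∈ys))
    ... | inj₁ z∈us = ∈-++⁺ˡ z∈us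
    ... | inj₂ (here refl) = ⊥-elim (All.lookup y∉ys z∈ys refl)
    ... | inj₂ (there z∈vs) = ∈-++⁺ʳ us z∈vs

  unique-map : ∀ {p} {B C : Set} {P : Pred A p} (g : A → B) (h : A → C) →
               (∀ {x y} → P x → P y → g x ≡ g y → h x ≡ h y) →
               {xs : List A} → All P xs → Unique (map h xs) → Unique (map g xs)
  unique-map g h g-reflects [] [] = []
  unique-map {P = P} g h g-reflects {x ∷ xs} (px ∷ pxs) (hx∉hxs ∷ hxs-unique) =
    gx∉gxs pxs hx∉hxs ∷ unique-map g h g-reflects pxs hxs-unique
    where
    gx∉gxs : ∀ {zs} → All P zs → All (h x ≢_) (map h zs) → All (g x ≢_) (map g zs)
    gx∉gxs {[]} [] [] = []
    gx∉gxs {_ ∷ _} (pz ∷ pzs) (hx≢hz ∷ hx≢hzs) = (λ gx≡gz → hx≢hz (g-reflects px pz gx≡gz)) ∷ gx∉gxs pzs hx≢hzs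

[_] : ∀ {P : Set} → Dec P → ℕ
[ yes _ ] = 1
[ no _ ] = 0

module Counting {n : ℕ} {A : Set} (enumeration : A ↔ Fin n) where

  open import Data.Nat using (_+_; _*_)

  open Inverse enumeration using (to; from; strictlyInverseˡ; strictlyInverseʳ)

  to-injective : ∀ {x y} → to x ≡ to y → x ≡ y
  to-injective {x} {y} e = trans (sym (strictlyInverseʳ x)) (trans (cong from e) (strictlyInverseʳ y))

  infix 4 _≟_
  _≟_ : DecidableEquality A
  x ≟ y with to x Fin.≟ to y
  ... | yes e = yes (to-injective e)
  ... | no ne = no (λ e → ne (cong to e))

  elements : List A
  elements = tabulate from

  ∈-elements : ∀ x → x ∈ elements
  ∈-elements x = subst (_∈ elements) (strictlyInverseʳ x) (∈-tabulate⁺ (to x))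

  elements-unique : Unique elements
  elements-unique = Unique.tabulate⁺ λ {i} {j} e → trans (sym (strictlyInverseˡ i)) (trans (cong to e) (strictlyInverseˡ j))

  ∑ : (A → ℕ) → ℕ
  ∑ f = sum (map f elements)

  private
    sum-map-mono : ∀ {f g : A → ℕ} → (∀ x → f x ≤ g x) → ∀ xs → sum (map f xs) ≤ sum (map g xs)
    sum-map-mono f≤g [] = z≤n
    sum-map-mono f≤g (x ∷ xs) = ℕ.+-mono-≤ (f≤g x) (sum-map-mono f≤g xs)

    sum-map-+ : ∀ (f g : A → ℕ) xs → sum (map (λ x → f x + g x) xs) ≡ sum (map f xs) + sum (map g xs)
    sum-map-+ f g [] = refl
    sum-map-+ f g (x ∷ xs) = trans (cong (f x + g x +_) (sum-map-+ f g xs)) (interchange (f x) (g x) _ _)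

    sum-map-1 : ∀ (xs : List A) → sum (map (λ _ → 1) xs) ≡ length xs
    sum-map-1 [] = refl
    sum-map-1 (x ∷ xs) = cong suc (sum-map-1 xs)

  ∑-mono : ∀ {f g : A → ℕ} → (∀ x → f x ≤ g x) → ∑ f ≤ ∑ g
  ∑-mono f≤g = sum-map-mono f≤g elements

  ∑-cong : ∀ {f g : A → ℕ} → (∀ x → f x ≡ g x) → ∑ f ≡ ∑ g
  ∑-cong f≡g = ℕ.≤-antisym (∑-mono (λ x → ℕ.≤-reflexive (f≡g x))) (∑-mono (λ x → ℕ.≤-reflexive (sym (f≡g x))))

  ∑-+ : ∀ (f g : A → ℕ) → ∑ (λ x → f x + g x) ≡ ∑ f + ∑ g
  ∑-+ f g = sum-map-+ f g elements

  ∑-1 : ∑ (λ _ → 1) ≡ n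
  ∑-1 = trans (sum-map-1 elements) (List.length-tabulate from)

  ∣_∣ : {P : A → Set} → Decidable P → ℕ
  ∣ P? ∣ = ∑ (λ x → [ P? x ])

  module _ {P : A → Set} (P? : Decidable P) where

    count≡length-filter : ∣ P? ∣ ≡ length (filter P? elements)
    count≡length-filter = go elements
      where
      go : ∀ xs → sum (map (λ x → [ P? x ]) xs) ≡ length (filter P? xs)
      go [] = refl
      go (x ∷ xs) with P? x
      ... | yes _ = cong suc (go xs)
      ... | no _ = go xs

    count-≤-n : ∣ P? ∣ ≤ n
    count-≤-n = subst (∣ P? ∣ ≤_) ∑-1 (∑-mono [P?]≤1)
      where
      [P?]≤1 : ∀ x → [ P? x ] ≤ 1
      [P?]≤1 x with P? x
      ... | yes _ = s≤s z≤n
      ... | no _ = z≤n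

    count-complement : ∣ P? ∣ + ∣ ∁? P? ∣ ≡ n
    count-complement = trans (sym (∑-+ _ _)) (trans (∑-cong [P]+[∁P]≡1) ∑-1)
      where
      [P]+[∁P]≡1 : ∀ x → [ P? x ] + [ ∁? P? x ] ≡ 1
      [P]+[∁P]≡1 x with P? x
      ... | yes _ = refl
      ... | no _ = refl

    satisfiable : 0 < ∣ P? ∣ → Satisfiable P
    satisfiable 0<∣P∣ with filter P? elements in eq
    ... | [] = ⊥-elim (ℕ.<-irrefl (sym (trans count≡length-filter (cong length eq))) 0<∣P∣)
    ... | x ∷ _ = x , All.head (subst (All P) eq (all-filter P? elements))

    count-empty : (∀ x → ¬ P x) → ∣ P? ∣ ≡ 0
    count-empty ¬P = ℕ.n≤0⇒n≡0 (ℕ.≮⇒≥ λ 0<∣P∣ → let (x , px) = satisfiable 0<∣P∣ in ¬P x px)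

  count-≤-injection : {P Q : A → Set} (P? : Decidable P) (Q? : Decidable Q) (g : A → A) →
                      (∀ {x} → P x → Q (g x)) → (∀ {x y} → P x → P y → g x ≡ g y → x ≡ y) →
                      ∣ P? ∣ ≤ ∣ Q? ∣
  count-≤-injection P? Q? g P→Q∘g g-inj = begin
    ∣ P? ∣                                 ≡⟨ count≡length-filter P? ⟩
    length (filter P? elements)            ≡⟨ List.length-map g (filter P? elements) ⟨
    length (map g (filter P? elements))    ≤⟨ length-≤-of-⊆ g[P]-unique g[P]⊆Q ⟩
    length (filter Q? elements)            ≡⟨ count≡length-filter Q? ⟨
    ∣ Q? ∣                                 ∎
    where
    open ℕ.≤-Reasoning
    g[P]-unique : Unique (map g (filter P? elements))
    g[P]-unique = unique-map g (λ x → x) g-inj (all-filter P? elements)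
                     (subst Unique (sym (List.map-id (filter P? elements))) (Unique.filter⁺ P? {elements} elements-unique))
    g[P]⊆Q : ∀ {y} → y ∈ map g (filter P? elements) → y ∈ filter Q? elements
    g[P]⊆Q y∈ with ∈-map⁻ g y∈
    ... | x , x∈ , refl = ∈-filter⁺ Q? (∈-elements (g x)) (P→Q∘g (proj₂ (∈-filter⁻ P? {xs = elements} x∈)))

  count-mono : {P Q : A → Set} (P? : Decidable P) (Q? : Decidable Q) → P ⊆ Q → ∣ P? ∣ ≤ ∣ Q? ∣
  count-mono P? Q? P⊆Q = count-≤-injection P? Q? (λ x → x) P⊆Q (λ _ _ e → e)

  count-cong : {P Q : A → Set} (P? : Decidable P) (Q? : Decidable Q) → P ⊆ Q → Q ⊆ P → ∣ P? ∣ ≡ ∣ Q? ∣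
  count-cong P? Q? P⊆Q Q⊆P = ℕ.≤-antisym (count-mono P? Q? P⊆Q) (count-mono Q? P? Q⊆P)

  count-pos : {P : A → Set} (P? : Decidable P) → ∀ {x} → P x → 0 < ∣ P? ∣
  count-pos P? {x} px = subst (0 <_) (sym (count≡length-filter P?)) (∈-length (∈-filter⁺ P? (∈-elements x) px))

  count-≤1 : {P : A → Set} (P? : Decidable P) → (∀ {x y} → P x → P y → x ≡ y) → ∣ P? ∣ ≤ 1
  count-≤1 {P} P? P-unique = subst (_≤ 1) (sym (count≡length-filter P?))
    (go (filter P? elements) (all-filter P? elements) (Unique.filter⁺ P? {elements} elements-unique))
    where
    go : ∀ xs → All P xs → Unique xs → length xs ≤ 1
    go [] _ _ = z≤n
    go (x ∷ xs) (px ∷ pxs) u = length-≤-of-⊆ {xs = x ∷ []} u λ y∈ → here (P-unique (All.lookup (px ∷ pxs) y∈) px)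

  count-singleton : ∀ a → ∣ (_≟ a) ∣ ≡ 1
  count-singleton a = ℕ.≤-antisym (count-≤1 (_≟ a) (λ x≡a y≡a → trans x≡a (sym y≡a))) (count-pos (_≟ a) refl)

  count-∘-involution : {P : A → Set} (P? : Decidable P) (σ : A → A) → (∀ x → σ (σ x) ≡ x) →
                       ∣ (λ x → P? (σ x)) ∣ ≡ ∣ P? ∣
  count-∘-involution {P} P? σ σ-involutive = ℕ.≤-antisym
    (count-≤-injection (λ x → P? (σ x)) P? σ (λ p → p) (λ _ _ → σ-injective))
    (count-≤-injection P? (λ x → P? (σ x)) σ (λ {x} p → subst P (sym (σ-involutive x)) p) (λ _ _ → σ-injective))
    where
    σ-injective : ∀ {x y} → σ x ≡ σ y → x ≡ y
    σ-injective {x} {y} e = trans (sym (σ-involutive x)) (trans (cong σ e) (σ-involutive y))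

  module _ {P Q : A → Set} (P? : Decidable P) (Q? : Decidable Q) where

    count-∪-∩ : ∣ P? ∣ + ∣ Q? ∣ ≡ ∣ P? ∪? Q? ∣ + ∣ P? ∩? Q? ∣
    count-∪-∩ = trans (sym (∑-+ _ _)) (trans (∑-cong pointwise) (∑-+ _ _))
      where
      pointwise : ∀ x → [ P? x ] + [ Q? x ] ≡ [ (P? ∪? Q?) x ] + [ (P? ∩? Q?) x ]
      pointwise x with P? x | Q? x
      ... | yes _ | yes _ = refl
      ... | yes _ | no _ = refl
      ... | no _ | yes _ = refl
      ... | no _ | no _ = refl

    count-split : ∣ P? ∣ ≡ ∣ P? ∩? Q? ∣ + ∣ P? ∩? ∁? Q? ∣
    count-split = trans (∑-cong pointwise) (∑-+ _ _)
      where
      pointwise : ∀ x → [ P? x ] ≡ [ (P? ∩? Q?) x ] + [ (P? ∩? ∁? Q?) x ]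
      pointwise x with P? x | Q? x
      ... | yes _ | yes _ = refl
      ... | yes _ | no _ = refl
      ... | no _ | yes _ = refl
      ... | no _ | no _ = refl

  -- An arbitrary total order transported from Fin n; it serves only to pick one element
  -- out of each orbit of an involution.
  infix 4 _≼_ _≼?_
  _≼_ : A → A → Set
  x ≼ y = to x Fin.≤ to y

  _≼?_ : ∀ x y → Dec (x ≼ y)
  x ≼? y = to x Fin.≤? to y

  ≼-antisym : ∀ {x y} → x ≼ y → y ≼ x → x ≡ y
  ≼-antisym x≼y y≼x = to-injective (Fin.≤-antisym x≼y y≼x)

  ≼-total : ∀ x y → x ≼ y ⊎ y ≼ x
  ≼-total x y = Fin.≤-total (to x) (to y)

  ≼-reflexive : ∀ {x y} → x ≡ y → x ≼ y
  ≼-reflexive refl = Fin.≤-refl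

  count-involution : (σ : A → A) → (∀ x → σ (σ x) ≡ x) →
                     2 * ∣ (λ x → x ≼? σ x) ∣ ≡ n + ∣ (λ x → σ x ≟ x) ∣
  count-involution σ σ-involutive = begin
    2 * ∣ ≼σ? ∣                        ≡⟨ cong (∣ ≼σ? ∣ +_) (ℕ.+-identityʳ ∣ ≼σ? ∣) ⟩
    ∣ ≼σ? ∣ + ∣ ≼σ? ∣                  ≡⟨ cong (∣ ≼σ? ∣ +_) (count-∘-involution ≼σ? σ σ-involutive) ⟨
    ∣ ≼σ? ∣ + ∣ (λ x → ≼σ? (σ x)) ∣    ≡⟨ trans (sym (∑-+ _ _)) (trans (∑-cong pointwise) (∑-+ _ _)) ⟩
    ∑ (λ _ → 1) + ∣ Fix? ∣             ≡⟨ cong (_+ ∣ Fix? ∣) ∑-1 ⟩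
    n + ∣ Fix? ∣                       ∎
    where
    open ≡-Reasoning
    ≼σ? : Decidable (λ x → x ≼ σ x)
    ≼σ? x = x ≼? σ x
    Fix? : Decidable (λ x → σ x ≡ x)
    Fix? x = σ x ≟ x
    pointwise : ∀ x → [ ≼σ? x ] + [ ≼σ? (σ x) ] ≡ 1 + [ Fix? x ]
    pointwise x rewrite σ-involutive x with x ≼? σ x | σ x ≼? x | σ x ≟ x
    ... | yes _ | yes _ | yes _ = refl
    ... | yes x≼σx | yes σx≼x | no σx≢x = ⊥-elim (σx≢x (≼-antisym σx≼x x≼σx))
    ... | yes _ | no σx⋠x | yes σx≡x = ⊥-elim (σx⋠x (≼-reflexive σx≡x))
    ... | no x⋠σx | _ | yes σx≡x = ⊥-elim (x⋠σx (≼-reflexive (sym σx≡x)))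
    ... | yes _ | no _ | no _ = refl
    ... | no _ | yes _ | no _ = refl
    ... | no x⋠σx | no σx⋠x | no _ = ⊥-elim (σx⋠x (ℕ.≰⇒≥ x⋠σx))

module FieldProperties {q : ℕ} (F : FiniteField q) where

  open FiniteField F public
  open IntegerCoefficientSolver isCommutativeRing public
  open Counting enumeration public

  commutativeRing : CommutativeRing 0ℓ 0ℓ
  commutativeRing = record { isCommutativeRing = isCommutativeRing }

  open CommutativeRing commutativeRing public
    using (+-identityˡ; +-identityʳ; +-assoc; +-comm; -‿inverseʳ; *-comm; ring)
  open import Algebra.Properties.Ring ring public using (-‿involutive; -0#≈0#)
  open ≡-Reasoning

  x-y≡0⇒x≡y : ∀ {x y} → x - y ≡ 0# → x ≡ y
  x-y≡0⇒x≡y {x} {y} x-y≡0 = begin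
    x             ≡⟨ solve 2 (λ x y → x := (x :- y) :+ y) refl x y ⟩
    (x - y) + y   ≡⟨ cong (_+ y) x-y≡0 ⟩
    0# + y        ≡⟨ +-identityˡ y ⟩
    y             ∎

  x≡y⇒x-y≡0 : ∀ {x y} → x ≡ y → x - y ≡ 0#
  x≡y⇒x-y≡0 {x} refl = -‿inverseʳ x

  *-zero⇒zero : ∀ {x y} → x * y ≡ 0# → x ≡ 0# ⊎ y ≡ 0#
  *-zero⇒zero {x} {y} xy≡0 with x ≟ 0#
  ... | yes x≡0 = inj₁ x≡0
  ... | no x≢0 with inverse x x≢0
  ... | x⁻¹ , xx⁻¹≡1 = inj₂ (begin
    y               ≡⟨ solve 3 (λ x y i → y := (i :* (x :* y)) :+ (con (ℤ.+ 1) :- x :* i) :* y) refl x y x⁻¹ ⟩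
    x⁻¹ * (x * y) + (1# - x * x⁻¹) * y ≡⟨ cong₂ (λ a b → x⁻¹ * a + (1# - b) * y) xy≡0 xx⁻¹≡1 ⟩
    x⁻¹ * 0# + (1# - 1#) * y           ≡⟨ solve 2 (λ i y → i :* con (ℤ.+ 0) :+ (con (ℤ.+ 1) :- con (ℤ.+ 1)) :* y
                                                       := con (ℤ.+ 0)) refl x⁻¹ y ⟩
    0#              ∎)

  *-cancelˡ : ∀ {x y z} → x ≢ 0# → x * y ≡ x * z → y ≡ z
  *-cancelˡ {x} {y} {z} x≢0 xy≡xz with *-zero⇒zero x[y-z]≡0
    where
    x[y-z]≡0 : x * (y - z) ≡ 0#
    x[y-z]≡0 = trans (solve 3 (λ x y z → x :* (y :- z) := x :* y :- x :* z) refl x y z) (x≡y⇒x-y≡0 xy≡xz)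
  ... | inj₁ x≡0 = ⊥-elim (x≢0 x≡0)
  ... | inj₂ y-z≡0 = x-y≡0⇒x≡y y-z≡0

  square-roots : ∀ {x y} → x * x ≡ y * y → x ≡ y ⊎ x ≡ - y
  square-roots {x} {y} x²≡y² with *-zero⇒zero [x-y][x+y]≡0
    where
    [x-y][x+y]≡0 : (x - y) * (x + y) ≡ 0#
    [x-y][x+y]≡0 = trans (solve 2 (λ x y → (x :- y) :* (x :+ y) := x :* x :- y :* y) refl x y) (x≡y⇒x-y≡0 x²≡y²)
  ... | inj₁ x-y≡0 = inj₁ (x-y≡0⇒x≡y x-y≡0)
  ... | inj₂ x+y≡0 = inj₂ (x-y≡0⇒x≡y (trans (solve 2 (λ x y → x :- (:- y) := x :+ y) refl x y) x+y≡0))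

  +-cancelˡ : ∀ {a x y} → a + x ≡ a + y → x ≡ y
  +-cancelˡ {a} {x} {y} a+x≡a+y = begin
    x                 ≡⟨ solve 2 (λ a x → x := :- a :+ (a :+ x)) refl a x ⟩
    - a + (a + x)     ≡⟨ cong (- a +_) a+x≡a+y ⟩
    - a + (a + y)     ≡⟨ solve 2 (λ a y → :- a :+ (a :+ y) := y) refl a y ⟩
    y                 ∎

  _⁻¹ : Carrier → Carrier
  x ⁻¹ with x ≟ 0#
  ... | yes _ = 0#
  ... | no x≢0 = proj₁ (inverse x x≢0)

  ⁻¹-inverseʳ : ∀ {x} → x ≢ 0# → x * x ⁻¹ ≡ 1#
  ⁻¹-inverseʳ {x} x≢0 with x ≟ 0#
  ... | yes x≡0 = ⊥-elim (x≢0 x≡0)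
  ... | no x≢0 = proj₂ (inverse x x≢0)

  IsSquare? : Decidable IsSquare
  IsSquare? s with Any.any? (λ y → y * y ≟ s) elements
  ... | yes root = yes (Any.satisfied root)
  ... | no ¬root = no λ (y , y²≡s) → ¬root (Any.map (λ { refl → y²≡s }) (∈-elements y))

  nonsquare-*-square : ∀ {λ' w} → ¬ IsSquare λ' → w ≢ 0# → ¬ IsSquare (λ' * (w * w))
  nonsquare-*-square {λ'} {w} λ'-nonsquare w≢0 (y , y²≡λ'w²) with inverse w w≢0
  ... | w⁻¹ , ww⁻¹≡1 = λ'-nonsquare (y * w⁻¹ , (begin
    (y * w⁻¹) * (y * w⁻¹)           ≡⟨ solve 2 (λ y i → (y :* i) :* (y :* i) := (y :* y) :* (i :* i)) refl y w⁻¹ ⟩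
    (y * y) * (w⁻¹ * w⁻¹)           ≡⟨ cong (_* (w⁻¹ * w⁻¹)) y²≡λ'w² ⟩
    (λ' * (w * w)) * (w⁻¹ * w⁻¹)    ≡⟨ solve 3 (λ l w i → (l :* (w :* w)) :* (i :* i) := l :* ((w :* i) :* (w :* i)))
                                               refl λ' w w⁻¹ ⟩
    λ' * ((w * w⁻¹) * (w * w⁻¹))    ≡⟨ cong (λ e → λ' * (e * e)) ww⁻¹≡1 ⟩
    λ' * (1# * 1#)                  ≡⟨ solve 1 (λ l → l :* (con (ℤ.+ 1) :* con (ℤ.+ 1)) := l) refl λ' ⟩
    λ'                              ∎))

module OddCharacteristic {q : ℕ} (F : FiniteField q) (q-odd : ¬ 2 ∣ q) where

  open FieldProperties F public

  -- Otherwise translation by 1 would be a fixed-point-free involution, making q even.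
  1+1≢0 : 1# + 1# ≢ 0#
  1+1≢0 1+1≡0 = q-odd (divides ∣ ≼σ? ∣ (begin
    q                    ≡⟨ ℕ.+-identityʳ q ⟨
    q ℕ.+ 0              ≡⟨ cong (q ℕ.+_) (count-empty Fix? (λ x x+1≡x → 0≢1 (sym (x+y≡x⇒y≡0 x+1≡x)))) ⟨
    q ℕ.+ ∣ Fix? ∣       ≡⟨ count-involution σ σ-involutive ⟨
    2 ℕ.* ∣ ≼σ? ∣        ≡⟨ ℕ.*-comm 2 ∣ ≼σ? ∣ ⟩
    ∣ ≼σ? ∣ ℕ.* 2        ∎))
    where
    σ : Carrier → Carrier
    σ x = x + 1#
    σ-involutive : ∀ x → σ (σ x) ≡ x
    σ-involutive x = trans (+-assoc x 1# 1#) (trans (cong (x +_) 1+1≡0) (+-identityʳ x))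
    ≼σ? : Decidable (λ x → x ≼ σ x)
    ≼σ? x = x ≼? σ x
    Fix? : Decidable (λ x → σ x ≡ x)
    Fix? x = σ x ≟ x
    open ≡-Reasoning
    x+y≡x⇒y≡0 : ∀ {x y} → x + y ≡ x → y ≡ 0#
    x+y≡x⇒y≡0 {x} {y} x+y≡x = trans (solve 2 (λ x y → y := (x :+ y) :- x) refl x y) (x≡y⇒x-y≡0 x+y≡x)

  x+x≡0⇒x≡0 : ∀ {x} → x + x ≡ 0# → x ≡ 0#
  x+x≡0⇒x≡0 {x} x+x≡0 with *-zero⇒zero (trans (solve 1 (λ x → (con (ℤ.+ 1) :+ con (ℤ.+ 1)) :* x := x :+ x) refl x) x+x≡0)
  ... | inj₁ 1+1≡0 = ⊥-elim (1+1≢0 1+1≡0)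
  ... | inj₂ x≡0 = x≡0

  -x≡x⇒x≡0 : ∀ {x} → - x ≡ x → x ≡ 0#
  -x≡x⇒x≡0 {x} -x≡x = x+x≡0⇒x≡0 (trans (cong (x +_) (sym -x≡x)) (-‿inverseʳ x))

  -- Selects one element of each pair {x, −x}, x ≠ 0 (and 0 itself); no order is meant.
  Nonnegative : Carrier → Set
  Nonnegative x = x ≼ - x

  Nonnegative? : Decidable Nonnegative
  Nonnegative? x = x ≼? - x

  nonnegative-total : ∀ x → Nonnegative x ⊎ Nonnegative (- x)
  nonnegative-total x with ≼-total x (- x)
  ... | inj₁ x≼-x = inj₁ x≼-x
  ... | inj₂ -x≼x = inj₂ (subst (- x ≼_) (sym (-‿involutive x)) -x≼x)

  nonnegative-both⇒0 : ∀ {x} → Nonnegative x → Nonnegative (- x) → x ≡ 0#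
  nonnegative-both⇒0 {x} x≥0 -x≥0 = -x≡x⇒x≡0 (≼-antisym (subst (- x ≼_) (-‿involutive x) -x≥0) x≥0)

  SameSign : Carrier → Carrier → Set
  SameSign x y = (Nonnegative x × Nonnegative y) ⊎ (¬ Nonnegative x × ¬ Nonnegative y)

  square-injective : ∀ {x y} → x * x ≡ y * y → SameSign x y → x ≡ y
  square-injective x²≡y² same with square-roots x²≡y²
  ... | inj₁ x≡y = x≡y
  square-injective {y = y} _ (inj₁ (x≥0 , y≥0)) | inj₂ refl = begin
    - y     ≡⟨ cong -_ y≡0 ⟩
    - 0#    ≡⟨ -0#≈0# ⟩
    0#      ≡⟨ y≡0 ⟨
    y       ∎
    where
    open ≡-Reasoning
    y≡0 : y ≡ 0#
    y≡0 = nonnegative-both⇒0 y≥0 x≥0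
  square-injective {y = y} _ (inj₂ (x≱0 , y≱0)) | inj₂ refl with nonnegative-total y
  ... | inj₁ y≥0 = ⊥-elim (y≱0 y≥0)
  ... | inj₂ -y≥0 = ⊥-elim (x≱0 -y≥0)

  abs : Carrier → Carrier
  abs x with Nonnegative? x
  ... | yes _ = x
  ... | no _ = - x

  abs-nonnegative : ∀ x → Nonnegative (abs x)
  abs-nonnegative x with Nonnegative? x
  ... | yes x≥0 = x≥0
  ... | no x≱0 with nonnegative-total x
  ...   | inj₁ x≥0 = ⊥-elim (x≱0 x≥0)
  ...   | inj₂ -x≥0 = -x≥0

  abs-square : ∀ x → abs x * abs x ≡ x * x
  abs-square x with Nonnegative? x
  ... | yes _ = refl
  ... | no _ = solve 1 (λ x → :- x :* :- x := x :* x) refl x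

  ±abs : ∀ x → x ≡ abs x ⊎ x ≡ - abs x
  ±abs x with Nonnegative? x
  ... | yes _ = inj₁ refl
  ... | no _ = inj₂ (sym (-‿involutive x))

  √ : Carrier → Carrier
  √ s with IsSquare? s
  ... | yes (y , _) = abs y
  ... | no _ = 0#

  √-square : ∀ {s} → IsSquare s → √ s * √ s ≡ s
  √-square {s} s-square with IsSquare? s
  ... | yes (y , y²≡s) = trans (abs-square y) y²≡s
  ... | no s-nonsquare = ⊥-elim (s-nonsquare s-square)

  √-nonnegative : ∀ {s} → IsSquare s → Nonnegative (√ s)
  √-nonnegative {s} s-square with IsSquare? s
  ... | yes (y , _) = abs-nonnegative y
  ... | no s-nonsquare = ⊥-elim (s-nonsquare s-square)

  count-nonnegative : 2 ℕ.* ∣ Nonnegative? ∣ ≡ q ℕ.+ 1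
  count-nonnegative = begin
    2 ℕ.* ∣ Nonnegative? ∣        ≡⟨ count-involution -_ -‿involutive ⟩
    q ℕ.+ ∣ (λ x → - x ≟ x) ∣     ≡⟨ cong (q ℕ.+_) (count-cong (λ x → - x ≟ x) (_≟ 0#) -x≡x⇒x≡0 λ { refl → -0#≈0# }) ⟩
    q ℕ.+ ∣ (_≟ 0#) ∣             ≡⟨ cong (q ℕ.+_) (count-singleton 0#) ⟩
    q ℕ.+ 1                       ∎
    where open ≡-Reasoning

  count-squares≡count-nonnegative : ∣ IsSquare? ∣ ≡ ∣ Nonnegative? ∣
  count-squares≡count-nonnegative = ℕ.≤-antisym
    (count-≤-injection IsSquare? Nonnegative? √ √-nonnegative
      λ s₁-square s₂-square √s₁≡√s₂ →
        trans (sym (√-square s₁-square)) (trans (cong (λ r → r * r) √s₁≡√s₂) (√-square s₂-square)))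
    (count-≤-injection Nonnegative? IsSquare? (λ x → x * x) (λ {x} _ → x , refl)
      λ x≥0 y≥0 x²≡y² → square-injective x²≡y² (inj₁ (x≥0 , y≥0)))

  count-squares : 2 ℕ.* ∣ IsSquare? ∣ ≡ q ℕ.+ 1
  count-squares = trans (cong (2 ℕ.*_) count-squares≡count-nonnegative) count-nonnegative

  count-≤-twice : {P Q : Carrier → Set} (P? : Decidable P) (Q? : Decidable Q) (g sign : Carrier → Carrier) →
    (∀ {x} → P x → Q (g x)) → (∀ {x y} → P x → P y → g x ≡ g y → SameSign (sign x) (sign y) → x ≡ y) →
    ∣ P? ∣ ≤ 2 ℕ.* ∣ Q? ∣
  count-≤-twice P? Q? g sign P→Q∘g g-inj = begin
    ∣ P? ∣                                          ≡⟨ count-split P? S? ⟩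
    ∣ P? ∩? S? ∣ ℕ.+ ∣ P? ∩? ∁? S? ∣                ≤⟨ ℕ.+-mono-≤ (injective-on S? λ sx sy → inj₁ (sx , sy))
                                                                   (injective-on (∁? S?) λ sx sy → inj₂ (sx , sy)) ⟩
    ∣ Q? ∣ ℕ.+ ∣ Q? ∣                               ≡⟨ cong (∣ Q? ∣ ℕ.+_) (ℕ.+-identityʳ ∣ Q? ∣) ⟨
    2 ℕ.* ∣ Q? ∣                                    ∎
    where
    open ℕ.≤-Reasoning
    S? : Decidable (λ x → Nonnegative (sign x))
    S? x = Nonnegative? (sign x)
    injective-on : {S : Carrier → Set} (S? : Decidable S) → (∀ {x y} → S x → S y → SameSign (sign x) (sign y)) →
                   ∣ P? ∩? S? ∣ ≤ ∣ Q? ∣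
    injective-on S? same = count-≤-injection (P? ∩? S?) Q? g (λ (px , _) → P→Q∘g px)
      λ (px , sx) (py , sy) gx≡gy → g-inj px py gx≡gy (same sx sy)

  module SumsOfTwoSquares (c : Carrier) (c≢0 : c ≢ 0#) where

    IsSquare[c-_]? : Decidable (λ t → IsSquare (c - t))
    IsSquare[c-_]? t = IsSquare? (c - t)

    Splitting : Carrier → Set
    Splitting t = IsSquare t × IsSquare (c - t)

    Splitting? : Decidable Splitting
    Splitting? = IsSquare? ∩? IsSquare[c-_]?

    splitting-exists : Σ Carrier Splitting
    splitting-exists = satisfiable Splitting? (ℕ.+-cancelˡ-≤ q 1 ∣ Splitting? ∣ (begin
      q ℕ.+ 1
        ≡⟨ count-squares ⟨
      ∣ IsSquare? ∣ ℕ.+ (∣ IsSquare? ∣ ℕ.+ 0)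
        ≡⟨ cong (∣ IsSquare? ∣ ℕ.+_) (trans (ℕ.+-identityʳ _) (sym c-t-involution)) ⟩
      ∣ IsSquare? ∣ ℕ.+ ∣ IsSquare[c-_]? ∣
        ≡⟨ count-∪-∩ IsSquare? IsSquare[c-_]? ⟩
      ∣ IsSquare? ∪? IsSquare[c-_]? ∣ ℕ.+ ∣ Splitting? ∣
        ≤⟨ ℕ.+-monoˡ-≤ ∣ Splitting? ∣ (count-≤-n (IsSquare? ∪? IsSquare[c-_]?)) ⟩
      q ℕ.+ ∣ Splitting? ∣ ∎))
      where
      open ℕ.≤-Reasoning
      c-t-involution : ∣ IsSquare[c-_]? ∣ ≡ ∣ IsSquare? ∣
      c-t-involution = count-∘-involution IsSquare? (λ t → c - t) (solve 2 (λ c t → c :- (c :- t) := t) refl c)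

    point : Σ Carrier λ w₀ → Σ Carrier λ z₀ → w₀ * w₀ + z₀ * z₀ ≡ c × z₀ ≢ 0#
    point with splitting-exists
    ... | t , t-square , c-t-square with √ (c - t) ≟ 0#
    ...   | no √[c-t]≢0 = √ t , √ (c - t) , sum≡c , √[c-t]≢0
      where
      sum≡c : √ t * √ t + √ (c - t) * √ (c - t) ≡ c
      sum≡c = trans (cong₂ _+_ (√-square t-square) (√-square c-t-square)) (solve 2 (λ t c → t :+ (c :- t) := c) refl t c)
    ...   | yes √[c-t]≡0 = √ (c - t) , √ t , sum≡c , √t≢0
      where
      sum≡c : √ (c - t) * √ (c - t) + √ t * √ t ≡ c
      sum≡c = trans (cong₂ _+_ (√-square c-t-square) (√-square t-square)) (solve 2 (λ t c → (c :- t) :+ t := c) refl t c)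
      √t≢0 : √ t ≢ 0#
      √t≢0 √t≡0 = c≢0 (trans (sym sum≡c) (trans (cong₂ (λ a b → a * a + b * b) √[c-t]≡0 √t≡0)
                    (solve 0 (con (ℤ.+ 0) :* con (ℤ.+ 0) :+ con (ℤ.+ 0) :* con (ℤ.+ 0) := con (ℤ.+ 0)) refl)))

    FirstCoordinate : Carrier → Set
    FirstCoordinate w = IsSquare (c - w * w)

    FirstCoordinate? : Decidable FirstCoordinate
    FirstCoordinate? w = IsSquare? (c - w * w)

    count-first-coordinates : ∣ FirstCoordinate? ∣ ≤ 2 ℕ.* ∣ Splitting? ∣
    count-first-coordinates = count-≤-twice FirstCoordinate? Splitting? (λ w → w * w) (λ w → w)
      (λ {w} c-w²-square → (w , refl) , c-w²-square)
      (λ _ _ w₁²≡w₂² same-sign → square-injective w₁²≡w₂² same-sign)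

    -- The line (w₀, z₀) + s·(1, m) meets w² + z² = c again at s = step m, i.e. at (w m, z m).
    module Slopes (w₀ z₀ : Carrier) (on-conic : w₀ * w₀ + z₀ * z₀ ≡ c) (z₀≢0 : z₀ ≢ 0#) where

      Regular : Carrier → Set
      Regular m = 1# + m * m ≢ 0#

      Regular? : Decidable Regular
      Regular? = ∁? (λ m → 1# + m * m ≟ 0#)

      e : Carrier → Carrier
      e m = w₀ + z₀ * m

      step : Carrier → Carrier
      step m = - (e m + e m) * (1# + m * m) ⁻¹

      w z : Carrier → Carrier
      w m = w₀ + step m
      z m = z₀ + m * step m

      on-conic-at : ∀ {m} → Regular m → w m * w m + z m * z m ≡ c
      on-conic-at {m} regular = begin
        w m * w m + z m * z m
          ≡⟨ solve 4 (λ w₀ z₀ m d →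
               let e = w₀ :+ z₀ :* m ; u = :- (e :+ e) :* d in
               (w₀ :+ u) :* (w₀ :+ u) :+ (z₀ :+ m :* u) :* (z₀ :+ m :* u)
                 := (w₀ :* w₀ :+ z₀ :* z₀) :+ u :* ((e :+ e) :+ :- (e :+ e) :* ((con (ℤ.+ 1) :+ m :* m) :* d)))
               refl w₀ z₀ m ((1# + m * m) ⁻¹) ⟩
        (w₀ * w₀ + z₀ * z₀) + step m * ((e m + e m) + - (e m + e m) * ((1# + m * m) * (1# + m * m) ⁻¹))
          ≡⟨ cong₂ (λ a b → a + step m * ((e m + e m) + - (e m + e m) * b)) on-conic (⁻¹-inverseʳ regular) ⟩
        c + step m * ((e m + e m) + - (e m + e m) * 1#)
          ≡⟨ solve 3 (λ c u x → c :+ u :* (x :+ :- x :* con (ℤ.+ 1)) := c) refl c (step m) (e m + e m) ⟩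
        c ∎
        where open ≡-Reasoning

      step≡0⇒e≡0 : ∀ {m} → Regular m → step m ≡ 0# → e m ≡ 0#
      step≡0⇒e≡0 {m} regular step≡0 with *-zero⇒zero step≡0
      ... | inj₁ -[e+e]≡0 = x+x≡0⇒x≡0 (trans (sym (-‿involutive _)) (trans (cong -_ -[e+e]≡0) -0#≈0#))
      ... | inj₂ inverse≡0 = ⊥-elim (0≢1 (begin
        0#                                 ≡⟨ solve 1 (λ x → con (ℤ.+ 0) := x :* con (ℤ.+ 0)) refl (1# + m * m) ⟩
        (1# + m * m) * 0#                  ≡⟨ cong ((1# + m * m) *_) inverse≡0 ⟨
        (1# + m * m) * (1# + m * m) ⁻¹     ≡⟨ ⁻¹-inverseʳ regular ⟩
        1#                                 ∎))
        where open ≡-Reasoning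

      slope-injective : ∀ {m₁ m₂} → Regular m₁ → Regular m₂ → w m₁ ≡ w m₂ → z m₁ ≡ z m₂ → m₁ ≡ m₂
      slope-injective {m₁} {m₂} regular₁ regular₂ w₁≡w₂ z₁≡z₂ with step m₁ ≟ 0#
      ... | no step₁≢0 = *-cancelˡ step₁≢0 (trans (*-comm _ _) (trans (+-cancelˡ z₁≡z₂') (*-comm _ _)))
        where
        z₁≡z₂' : z₀ + m₁ * step m₁ ≡ z₀ + m₂ * step m₁
        z₁≡z₂' = trans z₁≡z₂ (cong (λ s → z₀ + m₂ * s) (sym (+-cancelˡ w₁≡w₂)))
      ... | yes step₁≡0 = *-cancelˡ z₀≢0 (+-cancelˡ (trans e₁≡0 (sym e₂≡0)))
        where
        e₁≡0 : e m₁ ≡ 0#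
        e₁≡0 = step≡0⇒e≡0 regular₁ step₁≡0
        e₂≡0 : e m₂ ≡ 0#
        e₂≡0 = step≡0⇒e≡0 regular₂ (trans (sym (+-cancelˡ w₁≡w₂)) step₁≡0)

      count-regular : ∣ Regular? ∣ ≤ 2 ℕ.* ∣ FirstCoordinate? ∣
      count-regular = count-≤-twice Regular? FirstCoordinate? w z
        (λ {m} regular → z m , z-square regular)
        λ regular₁ regular₂ w₁≡w₂ same-sign → slope-injective regular₁ regular₂ w₁≡w₂
          (square-injective (trans (z-square regular₁) (trans (cong (λ x → c - x * x) w₁≡w₂) (sym (z-square regular₂)))) same-sign)
        where
        z-square : ∀ {m} → Regular m → z m * z m ≡ c - w m * w m
        z-square {m} regular = trans (solve 2 (λ a b → b := (a :+ b) :- a) refl (w m * w m) (z m * z m))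
                                     (cong (_- w m * w m) (on-conic-at regular))

      count-singular : ∣ ∁? Regular? ∣ ≤ 2
      count-singular = subst (λ k → ∣ ∁? Regular? ∣ ≤ 2 ℕ.* k) (count-singleton 0#)
        (count-≤-twice (∁? Regular?) (_≟ 0#) (λ _ → 0#) (λ m → m) (λ _ → refl)
          λ singular₁ singular₂ _ same-sign →
            square-injective (+-cancelˡ (trans (singular singular₁) (sym (singular singular₂)))) same-sign)
        where
        singular : ∀ {m} → ¬ Regular m → 1# + m * m ≡ 0#
        singular {m} ¬regular with 1# + m * m ≟ 0#
        ... | yes 1+m²≡0 = 1+m²≡0
        ... | no 1+m²≢0 = ⊥-elim (¬regular 1+m²≢0)

      count-splittings : q ≤ 2 ℕ.* (2 ℕ.* ∣ Splitting? ∣) ℕ.+ 2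
      count-splittings = begin
        q                                     ≡⟨ count-complement Regular? ⟨
        ∣ Regular? ∣ ℕ.+ ∣ ∁? Regular? ∣     ≤⟨ ℕ.+-mono-≤ (ℕ.≤-trans count-regular (ℕ.*-monoʳ-≤ 2 count-first-coordinates))
                                                              count-singular ⟩
        2 ℕ.* (2 ℕ.* ∣ Splitting? ∣) ℕ.+ 2   ∎
        where open ℕ.≤-Reasoning

    count-splittings : q ≤ 2 ℕ.* (2 ℕ.* ∣ Splitting? ∣) ℕ.+ 2
    count-splittings = let (w₀ , z₀ , on-conic , z₀≢0) = point in Slopes.count-splittings w₀ z₀ on-conic z₀≢0

  module LinearPolynomial (a b : Carrier) (a≢0 : a ≢ 0#) (b≢0 : b ≢ 0#) where

    f : Carrier → Carrier
    f x = a * x + b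

    f-injective : ∀ {x y} → f x ≡ f y → x ≡ y
    f-injective {x} {y} fx≡fy = *-cancelˡ a≢0 (+-cancelˡ (trans (+-comm b (a * x)) (trans fx≡fy (+-comm (a * y) b))))

    c : Carrier
    c = b + b

    c-f[-x]≡f[x] : ∀ x → c - f (- x) ≡ f x
    c-f[-x]≡f[x] = solve 3 (λ a b x → (b :+ b) :- (a :* :- x :+ b) := a :* x :+ b) refl a b

    c≢0 : c ≢ 0#
    c≢0 b+b≡0 = b≢0 (x+x≡0⇒x≡0 b+b≡0)

    open SumsOfTwoSquares c c≢0 public

    NonsquareAt± : Carrier → Set
    NonsquareAt± x = Nonnegative x × (¬ IsSquare (f x) ⊎ ¬ IsSquare (f (- x)))

    NonsquareAt±? : Decidable NonsquareAt±
    NonsquareAt±? x = Nonnegative? x ×-dec (¬? (IsSquare? (f x)) ⊎-dec ¬? (IsSquare? (f (- x))))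

    SquareAt± : Carrier → Set
    SquareAt± x = Nonnegative x × (IsSquare (f x) ⊎ IsSquare (f (- x)))

    SquareAt±? : Decidable SquareAt±
    SquareAt±? x = Nonnegative? x ×-dec (IsSquare? (f x) ⊎-dec IsSquare? (f (- x)))

    SignChange : Carrier → Set
    SignChange x = ¬ IsSquare (f x) × IsSquare (f (- x))

    SignChange? : Decidable SignChange
    SignChange? x = ¬? (IsSquare? (f x)) ×-dec IsSquare? (f (- x))

    count-mixed : ∣ NonsquareAt±? ∩? SquareAt±? ∣ ≤ ∣ SignChange? ∣
    count-mixed = count-≤-injection (NonsquareAt±? ∩? SquareAt±?) SignChange? flip mixed→sign-change
      λ (_ , (x≥0 , _)) (_ , (y≥0 , _)) flip[x]≡flip[y] →
        square-injective (trans (sym (flip-square _)) (trans (cong (λ z → z * z) flip[x]≡flip[y]) (flip-square _))) (inj₁ (x≥0 , y≥0))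
      where
      flip : Carrier → Carrier
      flip x with IsSquare? (f x)
      ... | yes _ = - x
      ... | no _ = x
      flip-square : ∀ x → flip x * flip x ≡ x * x
      flip-square x with IsSquare? (f x)
      ... | yes _ = solve 1 (λ x → :- x :* :- x := x :* x) refl x
      ... | no _ = refl
      mixed→sign-change : ∀ {x} → (NonsquareAt± ∩ SquareAt±) x → SignChange (flip x)
      mixed→sign-change {x} ((_ , nonsquare) , (_ , square)) with IsSquare? (f x) | nonsquare | square
      ... | yes fx-square | inj₁ fx-nonsquare | _ = ⊥-elim (fx-nonsquare fx-square)
      ... | yes fx-square | inj₂ f[-x]-nonsquare | _ = f[-x]-nonsquare , subst (λ z → IsSquare (f z)) (sym (-‿involutive x)) fx-square
      ... | no fx-nonsquare | _ | inj₁ fx-square = ⊥-elim (fx-nonsquare fx-square)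
      ... | no fx-nonsquare | _ | inj₂ f[-x]-square = fx-nonsquare , f[-x]-square

    count-sign-change : ∣ SignChange? ∣ ≤ ∣ IsSquare? ∩? ∁? IsSquare[c-_]? ∣
    count-sign-change = count-≤-injection SignChange? (IsSquare? ∩? ∁? IsSquare[c-_]?) (λ x → f (- x))
      (λ {x} (fx-nonsquare , f[-x]-square) → f[-x]-square , λ c-f[-x]-square → fx-nonsquare (subst IsSquare (c-f[-x]≡f[x] x) c-f[-x]-square))
      λ _ _ f[-x]≡f[-y] → trans (sym (-‿involutive _)) (trans (cong -_ (f-injective f[-x]≡f[-y])) (-‿involutive _))

    nonsquare±+square±+splittings≤q+1 : ∣ NonsquareAt±? ∣ ℕ.+ ∣ SquareAt±? ∣ ℕ.+ ∣ Splitting? ∣ ≤ q ℕ.+ 1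
    nonsquare±+square±+splittings≤q+1 = begin
      ∣ NonsquareAt±? ∣ ℕ.+ ∣ SquareAt±? ∣ ℕ.+ ∣ Splitting? ∣
        ≡⟨ cong (ℕ._+ ∣ Splitting? ∣) (count-∪-∩ NonsquareAt±? SquareAt±?) ⟩
      ∣ NonsquareAt±? ∪? SquareAt±? ∣ ℕ.+ ∣ NonsquareAt±? ∩? SquareAt±? ∣ ℕ.+ ∣ Splitting? ∣
        ≤⟨ ℕ.+-monoˡ-≤ ∣ Splitting? ∣ (ℕ.+-mono-≤ (count-mono _ Nonnegative? union-nonnegative)
                                                   (ℕ.≤-trans count-mixed count-sign-change)) ⟩
      ∣ Nonnegative? ∣ ℕ.+ ∣ IsSquare? ∩? ∁? IsSquare[c-_]? ∣ ℕ.+ ∣ Splitting? ∣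
        ≡⟨ ℕ.+-assoc ∣ Nonnegative? ∣ _ _ ⟩
      ∣ Nonnegative? ∣ ℕ.+ (∣ IsSquare? ∩? ∁? IsSquare[c-_]? ∣ ℕ.+ ∣ Splitting? ∣)
        ≡⟨ cong₂ ℕ._+_ count-squares≡count-nonnegative (ℕ.+-comm ∣ Splitting? ∣ _) ⟨
      ∣ IsSquare? ∣ ℕ.+ (∣ Splitting? ∣ ℕ.+ ∣ IsSquare? ∩? ∁? IsSquare[c-_]? ∣)
        ≡⟨ cong (∣ IsSquare? ∣ ℕ.+_) (count-split IsSquare? IsSquare[c-_]?) ⟨
      ∣ IsSquare? ∣ ℕ.+ ∣ IsSquare? ∣
        ≡⟨ trans (cong (∣ IsSquare? ∣ ℕ.+_) (sym (ℕ.+-identityʳ _))) count-squares ⟩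
      q ℕ.+ 1 ∎
      where
      open ℕ.≤-Reasoning
      union-nonnegative : ∀ {x} → (NonsquareAt± ∪ SquareAt±) x → Nonnegative x
      union-nonnegative (inj₁ (x≥0 , _)) = x≥0
      union-nonnegative (inj₂ (x≥0 , _)) = x≥0

module _ {A : Set} where

  triples : List A → List (A × A × A)
  triples (u ∷ v ∷ w ∷ r) = (u , v , w) ∷ triples (v ∷ w ∷ r)
  triples _ = []

  length-triples : ∀ xs → length (triples xs) ≡ length xs ∸ 2
  length-triples [] = refl
  length-triples (_ ∷ []) = refl
  length-triples (_ ∷ _ ∷ []) = refl
  length-triples (u ∷ v ∷ w ∷ r) = cong suc (length-triples (v ∷ w ∷ r))

  ∈-firsts : ∀ xs {y} → y ∈ map proj₁ (triples xs) → y ∈ xs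
  ∈-firsts (u ∷ v ∷ w ∷ r) (here y≡u) = here y≡u
  ∈-firsts (u ∷ v ∷ w ∷ r) (there y∈) = there (∈-firsts (v ∷ w ∷ r) y∈)

  unique-firsts : ∀ {xs} → Unique xs → Unique (map proj₁ (triples xs))
  unique-firsts {[]} _ = []
  unique-firsts {_ ∷ []} _ = []
  unique-firsts {_ ∷ _ ∷ []} _ = []
  unique-firsts {u ∷ v ∷ w ∷ r} (u∉ ∷ unique) =
    All.tabulate (λ y∈ → All.lookup u∉ (∈-firsts (v ∷ w ∷ r) y∈)) ∷ unique-firsts unique

module _ where

  open import Data.Nat using (_+_; _*_)
  open import Data.Nat.Solver using (module +-*-Solver)

  length-arithmetic : ∀ {ℓ t r q} → ℓ ≤ t + 2 → t + r ≤ q + 1 → q ≤ 2 * (2 * r) + 2 → 4 * ℓ ≤ 3 * q + 17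
  length-arithmetic {ℓ} {t} {r} {q} ℓ≤t+2 t+r≤q+1 q≤4r+2 = ℕ.≤-trans (ℕ.+-cancelʳ-≤ q (4 * ℓ) (3 * q + 14) (begin
    4 * ℓ + q                           ≤⟨ ℕ.+-mono-≤ (ℕ.*-monoʳ-≤ 4 ℓ≤t+2) q≤4r+2 ⟩
    4 * (t + 2) + (2 * (2 * r) + 2)     ≡⟨ solve 2 (λ t r → con 4 :* (t :+ con 2) :+ (con 2 :* (con 2 :* r) :+ con 2)
                                                         := con 4 :* (t :+ r) :+ con 10) refl t r ⟩
    4 * (t + r) + 10                    ≤⟨ ℕ.+-monoˡ-≤ 10 (ℕ.*-monoʳ-≤ 4 t+r≤q+1) ⟩
    4 * (q + 1) + 10                    ≡⟨ solve 1 (λ q → con 4 :* (q :+ con 1) :+ con 10 := con 3 :* q :+ con 14 :+ q) refl q ⟩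
    3 * q + 14 + q                      ∎)) (ℕ.+-monoʳ-≤ (3 * q) (ℕ.m≤m+n 14 3))
    where
    open ℕ.≤-Reasoning
    open +-*-Solver

module TypeOnePaths {q : ℕ} (F : FiniteField q) (q-odd : ¬ 2 ∣ q)
  (λ' : FiniteField.Carrier F) (λ'-nonsquare : ¬ FiniteField.IsSquare F λ')
  (a b : FiniteField.Carrier F) (a≢0 : a ≢ FiniteField.0# F) (b≢0 : b ≢ FiniteField.0# F) where

  open OddCharacteristic F q-odd
  open LinearPolynomial a b a≢0 b≢0
  open GraphDefs F

  weight-one : ∀ {x y} → Edge₁ λ' f x y → λ' * (y * y) ≡ f x
  weight-one (edge , y²≢fx) with *-zero⇒zero edge
  ... | inj₁ y²-fx≡0 = ⊥-elim (y²≢fx (x-y≡0⇒x≡y y²-fx≡0))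
  ... | inj₂ λ'y²-fx≡0 = x-y≡0⇒x≡y λ'y²-fx≡0

  nonsquare-before-weight-one : ∀ {x y} → Edge₁ λ' f x y → ¬ IsSquare (f x)
  nonsquare-before-weight-one {x} {y} e₁ with y ≟ 0#
  ... | no y≢0 = λ fx-square → nonsquare-*-square λ'-nonsquare y≢0 (subst IsSquare (sym (weight-one e₁)) fx-square)
  ... | yes refl = ⊥-elim (proj₂ e₁ (trans (sym (zero-λ'*)) (weight-one e₁)))
    where
    zero-λ'* : λ' * (0# * 0#) ≡ 0# * 0#
    zero-λ'* = solve 1 (λ l → l :* (con (ℤ.+ 0) :* con (ℤ.+ 0)) := con (ℤ.+ 0) :* con (ℤ.+ 0)) refl λ'

  Alternating : Carrier × Carrier × Carrier → Set
  Alternating (u , v , w) = (Edge₀ λ' f u v × Edge₁ λ' f v w) ⊎ (Edge₁ λ' f u v × Edge₀ λ' f v w)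

  alternating : ∀ {P} → ¬ ContainsTrail λ' f P 2 → ∀ pre {rest} → P ≡ pre ++ rest → IsPath λ' f rest →
                All Alternating (triples rest)
  alternating no-trail pre {[]} _ _ = []
  alternating no-trail pre {_ ∷ []} _ _ = []
  alternating no-trail pre {_ ∷ _ ∷ []} _ _ = []
  alternating {P} no-trail pre {u ∷ v ∷ w ∷ r} P≡pre++rest (unique , e₁ ∷ e₂ ∷ linked) =
    alternating-uvw ∷ alternating no-trail (pre ++ u ∷ []) P≡pre′++rest′ (AllPairs.tail unique , e₂ ∷ linked)
    where
    P≡pre′++rest′ : P ≡ (pre ++ u ∷ []) ++ v ∷ w ∷ r
    P≡pre′++rest′ = trans P≡pre++rest (sym (List.++-assoc pre (u ∷ []) (v ∷ w ∷ r)))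
    uvw-path : IsPath λ' f (u ∷ v ∷ w ∷ [])
    uvw-path = Unique.take⁺ 3 unique , e₁ ∷ e₂ ∷ [-]
    uvw-not-trail : ¬ IsTrail λ' f (u ∷ v ∷ w ∷ [])
    uvw-not-trail trail = no-trail (pre , _ , r , P≡pre++rest , trail , refl)
    alternating-uvw : Alternating (u , v , w)
    alternating-uvw with v * v ≟ f u | w * w ≟ f v
    ... | yes v²≡fu | yes w²≡fv = ⊥-elim (uvw-not-trail (uvw-path , inj₁ ((e₁ , v²≡fu) ∷ (e₂ , w²≡fv) ∷ [-])))
    ... | no v²≢fu | no w²≢fv = ⊥-elim (uvw-not-trail (uvw-path , inj₂ ((e₁ , v²≢fu) ∷ (e₂ , w²≢fv) ∷ [-])))
    ... | yes v²≡fu | no w²≢fv = inj₁ ((e₁ , v²≡fu) , (e₂ , w²≢fv))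
    ... | no v²≢fu | yes w²≡fv = inj₂ ((e₁ , v²≢fu) , (e₂ , w²≡fv))

  label : Carrier × Carrier × Carrier → Carrier ⊎ Carrier
  label (u , v , _) = if does (v * v ≟ f u) then inj₁ (abs v) else inj₂ (abs v)

  labels : List (Carrier ⊎ Carrier)
  labels = map inj₁ (filter NonsquareAt±? elements) ++ map inj₂ (filter SquareAt±? elements)

  at± : ∀ {P : Carrier → Set} {v} → P v → P (abs v) ⊎ P (- abs v)
  at± {P} {v} pv with ±abs v
  ... | inj₁ v≡abs = inj₁ (subst P v≡abs pv)
  ... | inj₂ v≡-abs = inj₂ (subst P v≡-abs pv)

  label-∈ : ∀ {t} → Alternating t → label t ∈ labels
  label-∈ {u , v , w} alt with v * v ≟ f u | alt
  ... | yes _ | inj₁ (_ , vw) = ∈-++⁺ˡ (∈-map⁺ inj₁ (∈-filter⁺ NonsquareAt±? (∈-elements (abs v))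
                                  (abs-nonnegative v , at± {λ x → ¬ IsSquare (f x)} (nonsquare-before-weight-one vw))))
  ... | yes v²≡fu | inj₂ (uv , _) = ⊥-elim (proj₂ uv v²≡fu)
  ... | no v²≢fu | inj₁ (uv , _) = ⊥-elim (v²≢fu (proj₂ uv))
  ... | no _ | inj₂ (_ , vw) = ∈-++⁺ʳ (map inj₁ (filter NonsquareAt±? elements))
                                 (∈-map⁺ inj₂ (∈-filter⁺ SquareAt±? (∈-elements (abs v))
                                   (abs-nonnegative v , at± {λ x → IsSquare (f x)} (w , proj₂ vw))))

  entering-edge : ∀ {u v w} → Alternating (u , v , w) → Edge λ' f u v
  entering-edge (inj₁ ((e , _) , _)) = e
  entering-edge (inj₂ ((e , _) , _)) = e

  label-injective : ∀ {t₁ t₂} → Alternating t₁ → Alternating t₂ → label t₁ ≡ label t₂ → proj₁ t₁ ≡ proj₁ t₂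
  label-injective {u₁ , v₁ , _} {u₂ , v₂ , _} alt₁ alt₂ label≡ with v₁ * v₁ ≟ f u₁ | v₂ * v₂ ≟ f u₂ | label≡
  ... | yes _ | no _ | ()
  ... | no _ | yes _ | ()
  ... | yes v₁²≡fu₁ | yes v₂²≡fu₂ | abs≡ = f-injective (begin
    f u₁          ≡⟨ v₁²≡fu₁ ⟨
    v₁ * v₁       ≡⟨ abs-square v₁ ⟨
    abs v₁ * abs v₁ ≡⟨ cong (λ x → x * x) (inj₁-injective abs≡) ⟩
    abs v₂ * abs v₂ ≡⟨ abs-square v₂ ⟩
    v₂ * v₂       ≡⟨ v₂²≡fu₂ ⟩
    f u₂          ∎)
    where open ≡-Reasoning
  ... | no v₁²≢fu₁ | no v₂²≢fu₂ | abs≡ = f-injective (begin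
    f u₁                  ≡⟨ weight-one (entering-edge alt₁ , v₁²≢fu₁) ⟨
    λ' * (v₁ * v₁)        ≡⟨ cong (λ' *_) (abs-square v₁) ⟨
    λ' * (abs v₁ * abs v₁) ≡⟨ cong (λ x → λ' * (x * x)) (inj₂-injective abs≡) ⟩
    λ' * (abs v₂ * abs v₂) ≡⟨ cong (λ' *_) (abs-square v₂) ⟩
    λ' * (v₂ * v₂)        ≡⟨ weight-one (entering-edge alt₂ , v₂²≢fu₂) ⟩
    f u₂                  ∎)
    where open ≡-Reasoning

  interior-bound : ∀ {P} → IsPath λ' f P → ¬ ContainsTrail λ' f P 2 → length P ≤ ∣ NonsquareAt±? ∣ ℕ.+ ∣ SquareAt±? ∣ ℕ.+ 2
  interior-bound {P} path no-trail = begin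
    length P                                ≤⟨ ℕ.m≤n+m∸n (length P) 2 ⟩
    2 ℕ.+ (length P ∸ 2)                    ≡⟨ ℕ.+-comm 2 _ ⟩
    (length P ∸ 2) ℕ.+ 2                    ≡⟨ cong (ℕ._+ 2) (length-triples P) ⟨
    length (triples P) ℕ.+ 2                ≡⟨ cong (ℕ._+ 2) (List.length-map label (triples P)) ⟨
    length (map label (triples P)) ℕ.+ 2    ≤⟨ ℕ.+-monoˡ-≤ 2 (length-≤-of-⊆ labels-unique (λ t∈ → label-∈′ t∈)) ⟩
    length labels ℕ.+ 2                     ≡⟨ cong (ℕ._+ 2) length-labels ⟩
    ∣ NonsquareAt±? ∣ ℕ.+ ∣ SquareAt±? ∣ ℕ.+ 2 ∎
    where
    open ℕ.≤-Reasoning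
    alt : All Alternating (triples P)
    alt = alternating no-trail [] refl path
    labels-unique : Unique (map label (triples P))
    labels-unique = unique-map label proj₁ label-injective alt (unique-firsts (proj₁ path))
    label-∈′ : ∀ {l} → l ∈ map label (triples P) → l ∈ labels
    label-∈′ l∈ with ∈-map⁻ label l∈
    ... | t , t∈ , refl = label-∈ (All.lookup alt t∈)
    length-labels : length labels ≡ ∣ NonsquareAt±? ∣ ℕ.+ ∣ SquareAt±? ∣
    length-labels = begin-equality
      length labels ≡⟨ List.length-++ (map inj₁ (filter NonsquareAt±? elements)) ⟩
      length (map inj₁ (filter NonsquareAt±? elements)) ℕ.+ length (map inj₂ (filter SquareAt±? elements))
        ≡⟨ cong₂ ℕ._+_ (List.length-map inj₁ (filter NonsquareAt±? elements)) (List.length-map inj₂ (filter SquareAt±? elements)) ⟩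
      length (filter NonsquareAt±? elements) ℕ.+ length (filter SquareAt±? elements)
        ≡⟨ cong₂ ℕ._+_ (count≡length-filter NonsquareAt±?) (count≡length-filter SquareAt±?) ⟨
      ∣ NonsquareAt±? ∣ ℕ.+ ∣ SquareAt±? ∣ ∎

  length-bound : ∀ {P} → IsPath λ' f P → ¬ ContainsTrail λ' f P 2 → 4 ℕ.* length P ≤ 3 ℕ.* q ℕ.+ 17
  length-bound path no-trail =
    length-arithmetic (interior-bound path no-trail) nonsquare±+square±+splittings≤q+1 count-splittings

open import Data.Nat using (_+_; _*_; _^_; _/_)
open import Data.Nat.DivMod using (m*n/n≡m; /-monoˡ-≤)
open import Data.Nat.Divisibility using (_∤_; ∣1⇒≡1)
open import Data.Nat.Primality using (Prime; euclidsLemma; prime[2]; ¬prime[1])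

prime∤⇒prime∤^ : ∀ {r p} → Prime r → r ∤ p → ∀ k → r ∤ p ^ k
prime∤⇒prime∤^ r-prime r∤p zero r∣1 with ∣1⇒≡1 r∣1
... | refl = ¬prime[1] r-prime
prime∤⇒prime∤^ {p = p} r-prime r∤p (suc k) r∣p^[1+k] with euclidsLemma p (p ^ k) r-prime r∣p^[1+k]
... | inj₁ r∣p = r∤p r∣p
... | inj₂ r∣p^k = prime∤⇒prime∤^ r-prime r∤p k r∣p^k

theorem2p9 : (p k q : ℕ) → Prime p → 2 ∤ p → 1 ≤ k → q ≡ p ^ k →
    (F : FiniteField q) →
    (λ' : FiniteField.Carrier F) → ¬ FiniteField.IsSquare F λ' →
    (a b : FiniteField.Carrier F) → a ≢ FiniteField.0# F → b ≢ FiniteField.0# F →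
    (P : List (FiniteField.Carrier F)) →
    GraphDefs.IsPath F λ' (linPoly F a b) P →
    GraphDefs.IsOfType F λ' (linPoly F a b) P 1 →
    length P ≤ (3 * q + 17) / 4
theorem2p9 p k q _ 2∤p _ refl F λ' λ'-nonsquare a b a≢0 b≢0 P path (_ , no-longer-trail) =
  subst (_≤ (3 * q + 17) / 4) (m*n/n≡m (length P) 4)
    (/-monoˡ-≤ 4 (subst (_≤ 3 * q + 17) (ℕ.*-comm 4 (length P))
      (length-bound path (no-longer-trail 2 (s≤s (s≤s z≤n))))))
  where
  open TypeOnePaths F (prime∤⇒prime∤^ prime[2] 2∤p k) λ' λ'-nonsquare a b a≢0 b≢0 using (length-bound)
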